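{- Let $(K,+,\cdot,0,1)$ be an absorptive semiring and let $\epsilon\in K$ with $\epsilon\cdot\epsilon=\epsilon$. Let $\pi\colon\mathrm{Lit}_A(\tau)\to K$ be a $K$-interpretation on a finite universe $A$ and $\pi_{\inf}$ the same map regarded as an interpretation into $K_{\inf}=(K,+,\sqcap,0,1)$. Then for every first-order formula $\psi(\bar x)$ (in negation normal form) and every tuple $\bar a$, $\pi_{\inf}[\![\psi(\bar a)]\!]=\epsilon$ implies $\pi[\![\psi(\bar a)]\!]=\epsilon$.
   Context: A commutative semiring $K$ is absorptive if $a+ab=a$ for all $a,b$; the natural order $a\le_K b:\Leftrightarrow a+b=b$ is then a partial order with $+$ as supremum. $K_{\inf}=(K,+,\sqcap,0,1)$ replaces multiplication by the infimum $\sqcap$ of the natural order (assumed to exist), giving a lattice semiring. $\tau$ is a finite relational vocabulary; a $K$-interpretation maps instantiated literals $R\bar a,\neg R\bar a$ over $A$ to $K$ with exactly one of $\pi(\alpha),\pi(\neg\alpha)$ zero per atom, and extends to formulae in negation normal form by valuing (in)equalities by $1/0$ according to truth, literals by $\pi$, $\lor,\exists$ by sum, $\land,\forall$ by the semiring product (in $K_{\inf}$: by $\sqcap$) over $A$. -}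

module Defs where

open import Level using (Level)
open import Data.Nat using (ℕ; zero; suc)
open import Data.Fin using (Fin; zero; suc; _≟_)
open import Data.Bool using (Bool; true; false)
open import Data.Product using (_×_; Σ)
open import Data.Sum using (_⊎_)
open import Relation.Nullary using (¬_; yes; no)
open import Algebra.Bundles using (CommutativeSemiring)

record Vocabulary : Set where
  field
    nRel  : ℕ
    arity : Fin nRel → ℕ
open Vocabulary public

-- First-order formulae over τ in negation normal form, with k free
-- variables (de Bruijn style, variables are Fin k).  Relational vocabulary:
-- terms are variables.
data Formula (τ : Vocabulary) : ℕ → Set where
  eq    : ∀ {k} → Fin k → Fin k → Formula τ k
  neq   : ∀ {k} → Fin k → Fin k → Formula τ k
  pos   : ∀ {k} (R : Fin (nRel τ)) → (Fin (arity τ R) → Fin k) → Formula τ k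
  neg   : ∀ {k} (R : Fin (nRel τ)) → (Fin (arity τ R) → Fin k) → Formula τ k
  _∧ᶠ_  : ∀ {k} → Formula τ k → Formula τ k → Formula τ k
  _∨ᶠ_  : ∀ {k} → Formula τ k → Formula τ k → Formula τ k
  ex    : ∀ {k} → Formula τ (suc k) → Formula τ k
  all   : ∀ {k} → Formula τ (suc k) → Formula τ k

-- Instantiated literals over the finite universe A = Fin n:
-- a relation symbol, a tuple of elements, and a polarity (true = R ā, false = ¬ R ā).
record Lit (τ : Vocabulary) (n : ℕ) : Set where
  constructor lit
  field
    rel      : Fin (nRel τ)
    tuple    : Fin (arity τ rel) → Fin n
    polarity : Bool

module _ {c ℓ : Level} (K : CommutativeSemiring c ℓ) where
  open CommutativeSemiring K using (Carrier; _≈_; _+_; _*_; 0#; 1#)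

  Absorptive : Set (c Level.⊔ ℓ)
  Absorptive = ∀ a b → (a + a * b) ≈ a

  _≤K_ : Carrier → Carrier → Set ℓ
  a ≤K b = (a + b) ≈ b

  IsInfimum : (Carrier → Carrier → Carrier) → Set (c Level.⊔ ℓ)
  IsInfimum _⊓_ = ∀ a b →
    ((a ⊓ b) ≤K a) × ((a ⊓ b) ≤K b) × (∀ z → z ≤K a → z ≤K b → z ≤K (a ⊓ b))

  IsKInterpretation : {τ : Vocabulary} {n : ℕ} → (Lit τ n → Carrier) → Set ℓ
  IsKInterpretation {τ} {n} π = ∀ (R : Fin (nRel τ)) (ā : Fin (arity τ R) → Fin n) →
    ((π (lit R ā true) ≈ 0#) × ¬ (π (lit R ā false) ≈ 0#))
    ⊎ (¬ (π (lit R ā true) ≈ 0#) × (π (lit R ā false) ≈ 0#))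

  fold : (Carrier → Carrier → Carrier) → Carrier → ∀ {n} → (Fin n → Carrier) → Carrier
  fold _∙_ e {zero}  f = e
  fold _∙_ e {suc n} f = f zero ∙ fold _∙_ e (λ i → f (suc i))

  extend : ∀ {n k} → (Fin k → Fin n) → Fin n → Fin (suc k) → Fin n
  extend ā b zero    = b
  extend ā b (suc i) = ā i

  -- semantics π[[ψ(ā)]] parametric in the "multiplication" used for ∧, ∀:
  -- _*_ gives the K-semantics, _⊓_ gives the K_inf-semantics.
  ⟦_⟧ : {τ : Vocabulary} {n k : ℕ} → (Carrier → Carrier → Carrier) →
        (Lit τ n → Carrier) → Formula τ k → (Fin k → Fin n) → Carrier
  ⟦ _·_ ⟧ π (eq x y) ā with ā x ≟ ā y
  ... | yes _ = 1#
  ... | no  _ = 0#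
  ⟦ _·_ ⟧ π (neq x y) ā with ā x ≟ ā y
  ... | yes _ = 0#
  ... | no  _ = 1#
  ⟦ _·_ ⟧ π (pos R xs) ā = π (lit R (λ i → ā (xs i)) true)
  ⟦ _·_ ⟧ π (neg R xs) ā = π (lit R (λ i → ā (xs i)) false)
  ⟦ _·_ ⟧ π (φ ∧ᶠ ψ) ā = ⟦ _·_ ⟧ π φ ā · ⟦ _·_ ⟧ π ψ ā
  ⟦ _·_ ⟧ π (φ ∨ᶠ ψ) ā = ⟦ _·_ ⟧ π φ ā + ⟦ _·_ ⟧ π ψ ā
  ⟦ _·_ ⟧ π (ex φ) ā  = fold _+_ 0# (λ b → ⟦ _·_ ⟧ π φ (extend ā b))
  ⟦ _·_ ⟧ π (all φ) ā = fold _·_ 1# (λ b → ⟦ _·_ ⟧ π φ (extend ā b))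

{-# OPTIONS --safe #-}
module Submission where

-- Since a · b ≤ a ⊓ b, the K-semantics is pointwise below the K_inf-semantics.
-- Conversely, (a + b)^(m + n) ≤ a^m + b^n and (a ⊓ b)^(m + n) ≤ a^m · b^n hold
-- in an absorptive semiring, so by induction some power π_inf[[ψ(ā)]]^d, with d
-- depending only on ψ and |A|, lies below π[[ψ(ā)]].  If π_inf[[ψ(ā)]] = ε with
-- ε idempotent, then ε = ε^d ≤ π[[ψ(ā)]] ≤ ε.

open import Defs
open import Level using (Level)
open import Data.Nat as ℕ using (ℕ; zero; suc)
import Data.Nat.Properties as ℕ
open import Data.Fin using (Fin; zero; suc; _≟_)
open import Data.Product using (proj₁; proj₂)
open import Relation.Nullary using (yes; no)
open import Relation.Binary.Bundles using (Poset)
import Relation.Binary.Reasoning.PartialOrder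
open import Relation.Binary.PropositionalEquality as ≡ using (subst)
open import Algebra.Bundles using (CommutativeSemiring)

module _ {c ℓ : Level} (K : CommutativeSemiring c ℓ) where
  open CommutativeSemiring K using (Carrier)

  fold-preserves : ∀ {r} (R : ℕ → Carrier → Carrier → Set r)
    {_∙_ _∘_ : Carrier → Carrier → Carrier} {e e′ : Carrier} {u d : ℕ} →
    (∀ {a b x x′ y y′} → R a x x′ → R b y y′ → R (a ℕ.+ b) (x ∙ y) (x′ ∘ y′)) →
    R u e e′ →
    ∀ {m} {f g : Fin m → Carrier} → (∀ i → R d (f i) (g i)) →
    R (m ℕ.* d ℕ.+ u) (fold K _∙_ e f) (fold K _∘_ e′ g)
  fold-preserves R compat unit {zero} fR = unit
  fold-preserves R {_∙_} {_∘_} {e} {e′} {u} {d} compat unit {suc m} {f} {g} fR =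
    subst (λ a → R a (fold K _∙_ e f) (fold K _∘_ e′ g)) (≡.sym (ℕ.+-assoc d (m ℕ.* d) u))
      (compat (fR zero) (fold-preserves R compat unit (λ i → fR (suc i))))

module AbsorptiveOrder {c ℓ : Level} (K : CommutativeSemiring c ℓ)
                       (absorptive : Absorptive K) where
  open CommutativeSemiring K
  open import Algebra.Properties.Semiring.Exp semiring using (_^_; ^-homo-*; ^-congʳ)

  infix 4 _≤_
  _≤_ : Carrier → Carrier → Set ℓ
  _≤_ = _≤K_ K

  +-idem : ∀ x → x + x ≈ x
  +-idem x = trans (+-congˡ (sym (*-identityʳ x))) (absorptive x 1#)

  ≤-reflexive : ∀ {x y} → x ≈ y → x ≤ y
  ≤-reflexive {x} {y} x≈y = trans (+-congʳ x≈y) (+-idem y)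

  ≤-trans : ∀ {x y z} → x ≤ y → y ≤ z → x ≤ z
  ≤-trans {x} {y} {z} x≤y y≤z = begin
    x + z       ≈⟨ +-congˡ y≤z ⟨
    x + (y + z) ≈⟨ +-assoc x y z ⟨
    (x + y) + z ≈⟨ +-congʳ x≤y ⟩
    y + z       ≈⟨ y≤z ⟩
    z           ∎
    where open import Relation.Binary.Reasoning.Setoid setoid

  ≤-antisym : ∀ {x y} → x ≤ y → y ≤ x → x ≈ y
  ≤-antisym {x} {y} x≤y y≤x = trans (sym y≤x) (trans (+-comm y x) x≤y)

  ≤-poset : Poset c ℓ ℓ
  ≤-poset = record
    { isPartialOrder = record
      { isPreorder = record
        { isEquivalence = isEquivalence
        ; reflexive     = ≤-reflexive
        ; trans         = ≤-trans
        }
      ; antisym = ≤-antisym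
      }
    }

  module ≤-Reasoning = Relation.Binary.Reasoning.PartialOrder ≤-poset

  x≤x+y : ∀ {x y} → x ≤ x + y
  x≤x+y {x} {y} = trans (sym (+-assoc x x y)) (+-congʳ (+-idem x))

  y≤x+y : ∀ {x y} → y ≤ x + y
  y≤x+y {x} {y} = ≤-trans x≤x+y (≤-reflexive (+-comm y x))

  +-least : ∀ {x y z} → x ≤ z → y ≤ z → x + y ≤ z
  +-least {x} {y} {z} x≤z y≤z = trans (+-assoc x y z) (trans (+-congˡ y≤z) x≤z)

  +-mono-≤ : ∀ {x x′ y y′} → x ≤ x′ → y ≤ y′ → x + y ≤ x′ + y′
  +-mono-≤ x≤x′ y≤y′ = +-least (≤-trans x≤x′ x≤x+y) (≤-trans y≤y′ y≤x+y)

  x*y≤x : ∀ {x y} → x * y ≤ x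
  x*y≤x {x} {y} = trans (+-comm (x * y) x) (absorptive x y)

  x*y≤y : ∀ {x y} → x * y ≤ y
  x*y≤y {x} {y} = ≤-trans (≤-reflexive (*-comm x y)) x*y≤x

  x≤1 : ∀ {x} → x ≤ 1#
  x≤1 {x} = ≤-trans (≤-reflexive (sym (*-identityˡ x))) x*y≤x

  *-monoˡ-≤ : ∀ {x y} z → x ≤ y → x * z ≤ y * z
  *-monoˡ-≤ {x} {y} z x≤y = trans (sym (distribʳ z x y)) (*-congʳ x≤y)

  *-monoʳ-≤ : ∀ {x y} z → x ≤ y → z * x ≤ z * y
  *-monoʳ-≤ {x} {y} z x≤y = begin
    z * x ≈⟨ *-comm z x ⟩
    x * z ≤⟨ *-monoˡ-≤ z x≤y ⟩
    y * z ≈⟨ *-comm y z ⟩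
    z * y ∎
    where open ≤-Reasoning

  *-mono-≤ : ∀ {x x′ y y′} → x ≤ x′ → y ≤ y′ → x * y ≤ x′ * y′
  *-mono-≤ {x′ = x′} {y} x≤x′ y≤y′ = ≤-trans (*-monoˡ-≤ y x≤x′) (*-monoʳ-≤ x′ y≤y′)

  ^-monoˡ-≤ : ∀ {x y} n → x ≤ y → x ^ n ≤ y ^ n
  ^-monoˡ-≤ zero    x≤y = ≤-reflexive refl
  ^-monoˡ-≤ (suc n) x≤y = *-mono-≤ x≤y (^-monoˡ-≤ n x≤y)

  x*[y+z]≤x*y+z : ∀ x y z → x * (y + z) ≤ x * y + z
  x*[y+z]≤x*y+z x y z = ≤-trans (≤-reflexive (distribˡ x y z)) (+-mono-≤ (≤-reflexive refl) x*y≤y)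

  [x+y]^[m+n]≤x^m+y^n : ∀ x y m n → (x + y) ^ (m ℕ.+ n) ≤ x ^ m + y ^ n
  [x+y]^[m+n]≤x^m+y^n x y zero    n       = ≤-trans x≤1 x≤x+y
  [x+y]^[m+n]≤x^m+y^n x y (suc m) zero    = ≤-trans x≤1 y≤x+y
  [x+y]^[m+n]≤x^m+y^n x y (suc m) (suc n) = begin
    (x + y) * s ^ (m ℕ.+ suc n)                 ≈⟨ distribʳ _ x y ⟩
    x * s ^ (m ℕ.+ suc n) + y * s ^ (m ℕ.+ suc n) ≈⟨ +-congˡ (*-congˡ (^-congʳ s (ℕ.+-suc m n))) ⟩
    x * s ^ (m ℕ.+ suc n) + y * s ^ (suc m ℕ.+ n) ≤⟨ +-least x-part y-part ⟩
    x ^ suc m + y ^ suc n                       ∎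
    where
    open ≤-Reasoning
    s = x + y
    x-part : x * s ^ (m ℕ.+ suc n) ≤ x ^ suc m + y ^ suc n
    x-part = begin
      x * s ^ (m ℕ.+ suc n)   ≤⟨ *-monoʳ-≤ x ([x+y]^[m+n]≤x^m+y^n x y m (suc n)) ⟩
      x * (x ^ m + y ^ suc n) ≤⟨ x*[y+z]≤x*y+z x _ _ ⟩
      x ^ suc m + y ^ suc n   ∎
    y-part : y * s ^ (suc m ℕ.+ n) ≤ x ^ suc m + y ^ suc n
    y-part = begin
      y * s ^ (suc m ℕ.+ n)   ≤⟨ *-monoʳ-≤ y ([x+y]^[m+n]≤x^m+y^n x y (suc m) n) ⟩
      y * (x ^ suc m + y ^ n) ≈⟨ *-congˡ (+-comm _ _) ⟩
      y * (y ^ n + x ^ suc m) ≤⟨ x*[y+z]≤x*y+z y _ _ ⟩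
      y ^ suc n + x ^ suc m   ≈⟨ +-comm _ _ ⟩
      x ^ suc m + y ^ suc n   ∎

  x*x≈x⇒x≤x^n : ∀ {x} → x * x ≈ x → ∀ n → x ≤ x ^ n
  x*x≈x⇒x≤x^n x*x≈x zero    = x≤1
  x*x≈x⇒x≤x^n {x} x*x≈x (suc n) =
    ≤-trans (≤-reflexive (sym x*x≈x)) (*-monoʳ-≤ x (x*x≈x⇒x≤x^n x*x≈x n))

  module Infimum (_⊓_ : Carrier → Carrier → Carrier) (isInfimum : IsInfimum K _⊓_) where

    x⊓y≤x : ∀ {x y} → x ⊓ y ≤ x
    x⊓y≤x {x} {y} = proj₁ (isInfimum x y)

    x⊓y≤y : ∀ {x y} → x ⊓ y ≤ y
    x⊓y≤y {x} {y} = proj₁ (proj₂ (isInfimum x y))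

    ⊓-greatest : ∀ {x y z} → z ≤ x → z ≤ y → z ≤ x ⊓ y
    ⊓-greatest {x} {y} {z} = proj₂ (proj₂ (isInfimum x y)) z

    *-⊓-mono-≤ : ∀ {x x′ y y′} → x ≤ x′ → y ≤ y′ → x * y ≤ x′ ⊓ y′
    *-⊓-mono-≤ x≤x′ y≤y′ = ⊓-greatest (≤-trans x*y≤x x≤x′) (≤-trans x*y≤y y≤y′)

    [x⊓y]^[m+n]≤x^m*y^n : ∀ x y m n → (x ⊓ y) ^ (m ℕ.+ n) ≤ x ^ m * y ^ n
    [x⊓y]^[m+n]≤x^m*y^n x y m n = ≤-trans (≤-reflexive (^-homo-* (x ⊓ y) m n))
      (*-mono-≤ (^-monoˡ-≤ m x⊓y≤x) (^-monoˡ-≤ n x⊓y≤y))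

    module Semantics {τ : Vocabulary} {n : ℕ} (π : Lit τ n → Carrier) where

      ⟦_⟧* ⟦_⟧⊓ : ∀ {k} → Formula τ k → (Fin k → Fin n) → Carrier
      ⟦_⟧* = ⟦_⟧ K _*_ π
      ⟦_⟧⊓ = ⟦_⟧ K _⊓_ π

      ⟦⟧*≤⟦⟧⊓ : ∀ {k} (ψ : Formula τ k) ā → ⟦ ψ ⟧* ā ≤ ⟦ ψ ⟧⊓ ā
      ⟦⟧*≤⟦⟧⊓ (eq x y) ā with ā x ≟ ā y
      ... | yes _ = ≤-reflexive refl
      ... | no  _ = ≤-reflexive refl
      ⟦⟧*≤⟦⟧⊓ (neq x y) ā with ā x ≟ ā y
      ... | yes _ = ≤-reflexive refl
      ... | no  _ = ≤-reflexive refl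
      ⟦⟧*≤⟦⟧⊓ (pos R xs) ā = ≤-reflexive refl
      ⟦⟧*≤⟦⟧⊓ (neg R xs) ā = ≤-reflexive refl
      ⟦⟧*≤⟦⟧⊓ (φ ∧ᶠ ψ) ā = *-⊓-mono-≤ (⟦⟧*≤⟦⟧⊓ φ ā) (⟦⟧*≤⟦⟧⊓ ψ ā)
      ⟦⟧*≤⟦⟧⊓ (φ ∨ᶠ ψ) ā = +-mono-≤ (⟦⟧*≤⟦⟧⊓ φ ā) (⟦⟧*≤⟦⟧⊓ ψ ā)
      ⟦⟧*≤⟦⟧⊓ (ex φ)  ā =
        fold-preserves K (λ _ → _≤_) {u = 0} {0} +-mono-≤ (≤-reflexive refl)
          (λ b → ⟦⟧*≤⟦⟧⊓ φ (extend K ā b))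
      ⟦⟧*≤⟦⟧⊓ (all φ) ā =
        fold-preserves K (λ _ → _≤_) {u = 0} {0} *-⊓-mono-≤ (≤-reflexive refl)
          (λ b → ⟦⟧*≤⟦⟧⊓ φ (extend K ā b))

      degree : ∀ {k} → Formula τ k → ℕ
      degree (φ ∧ᶠ ψ) = degree φ ℕ.+ degree ψ
      degree (φ ∨ᶠ ψ) = degree φ ℕ.+ degree ψ
      degree (ex φ)   = n ℕ.* degree φ ℕ.+ 1
      degree (all φ)  = n ℕ.* degree φ ℕ.+ 1
      degree _        = 1

      PowerBelow : ℕ → Carrier → Carrier → Set ℓ
      PowerBelow d x y = x ^ d ≤ y

      x^1≤x : ∀ {x} → x ^ 1 ≤ x
      x^1≤x {x} = ≤-reflexive (*-identityʳ x)

      ⟦⟧⊓^degree≤⟦⟧* : ∀ {k} (ψ : Formula τ k) ā → ⟦ ψ ⟧⊓ ā ^ degree ψ ≤ ⟦ ψ ⟧* ā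
      ⟦⟧⊓^degree≤⟦⟧* (eq x y) ā with ā x ≟ ā y
      ... | yes _ = x^1≤x
      ... | no  _ = x^1≤x
      ⟦⟧⊓^degree≤⟦⟧* (neq x y) ā with ā x ≟ ā y
      ... | yes _ = x^1≤x
      ... | no  _ = x^1≤x
      ⟦⟧⊓^degree≤⟦⟧* (pos R xs) ā = x^1≤x
      ⟦⟧⊓^degree≤⟦⟧* (neg R xs) ā = x^1≤x
      ⟦⟧⊓^degree≤⟦⟧* (φ ∧ᶠ ψ) ā = ≤-trans ([x⊓y]^[m+n]≤x^m*y^n _ _ (degree φ) (degree ψ))
        (*-mono-≤ (⟦⟧⊓^degree≤⟦⟧* φ ā) (⟦⟧⊓^degree≤⟦⟧* ψ ā))
      ⟦⟧⊓^degree≤⟦⟧* (φ ∨ᶠ ψ) ā = ≤-trans ([x+y]^[m+n]≤x^m+y^n _ _ (degree φ) (degree ψ))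
        (+-mono-≤ (⟦⟧⊓^degree≤⟦⟧* φ ā) (⟦⟧⊓^degree≤⟦⟧* ψ ā))
      ⟦⟧⊓^degree≤⟦⟧* (ex φ) ā =
        fold-preserves K PowerBelow
          (λ {a} {b} p q → ≤-trans ([x+y]^[m+n]≤x^m+y^n _ _ a b) (+-mono-≤ p q))
          x^1≤x (λ b → ⟦⟧⊓^degree≤⟦⟧* φ (extend K ā b))
      ⟦⟧⊓^degree≤⟦⟧* (all φ) ā =
        fold-preserves K PowerBelow
          (λ {a} {b} p q → ≤-trans ([x⊓y]^[m+n]≤x^m*y^n _ _ a b) (*-mono-≤ p q))
          x^1≤x (λ b → ⟦⟧⊓^degree≤⟦⟧* φ (extend K ā b))

mainTheorem15 : ∀ {c ℓ : Level} (K : CommutativeSemiring c ℓ) →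
    let open CommutativeSemiring K in
    Absorptive K →
    (_⊓_ : Carrier → Carrier → Carrier) → IsInfimum K _⊓_ →
    (ε : Carrier) → (ε * ε) ≈ ε →
    (τ : Vocabulary) (n : ℕ) (π : Lit τ n → Carrier) → IsKInterpretation K π →
    ∀ {k : ℕ} (ψ : Formula τ k) (ā : Fin k → Fin n) →
    ⟦_⟧ K _⊓_ π ψ ā ≈ ε → ⟦_⟧ K _*_ π ψ ā ≈ ε
mainTheorem15 K absorptive _⊓_ isInfimum ε ε*ε≈ε τ n π _ ψ ā ⟦ψ⟧⊓≈ε =
  ≤-antisym (≤-trans (⟦⟧*≤⟦⟧⊓ ψ ā) (≤-reflexive ⟦ψ⟧⊓≈ε)) ε≤⟦ψ⟧*
  where
  open CommutativeSemiring K using (sym)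
  open AbsorptiveOrder K absorptive
  open Infimum _⊓_ isInfimum
  open Semantics π
  open import Algebra.Properties.Semiring.Exp (CommutativeSemiring.semiring K) using (_^_; ^-congˡ)
  open ≤-Reasoning
  ε≤⟦ψ⟧* = begin
    ε                    ≤⟨ x*x≈x⇒x≤x^n ε*ε≈ε (degree ψ) ⟩
    ε ^ degree ψ         ≈⟨ ^-congˡ (degree ψ) (sym ⟦ψ⟧⊓≈ε) ⟩
    ⟦ ψ ⟧⊓ ā ^ degree ψ  ≤⟨ ⟦⟧⊓^degree≤⟦⟧* ψ ā ⟩
    ⟦ ψ ⟧* ā             ∎
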